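{- Let $G$ be a connected graph and let $v\in V(G)$ be a vertex that is not a cut vertex of $G$. Then $$\chi_d^t(G)-2\leq \chi_d^t(G-v)\leq \chi_d^t(G)+\deg(v)-1.$$
   Context: All graphs are simple and finite. For a graph $H$ with no isolated vertex, a total dominator coloring (TD-coloring) of $H$ is a proper vertex coloring of $H$ in which every vertex is adjacent to every vertex of some color class (a class other than its own). The total dominator chromatic number $\chi_d^t(H)$ is the minimum number of colors in a TD-coloring of $H$. $G-v$ is the graph obtained from $G$ by deleting $v$ and all edges incident to $v$. Implicitly, every graph whose $\chi_d^t$ appears has no isolated vertex. -}

module Defs where

open import Data.Nat using (ℕ; zero; suc)
open import Data.Fin using (Fin; punchIn)
open import Data.Bool using (Bool; T)
open import Data.List using (length; filterᵇ; allFin)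
open import Data.Product using (Σ; ∃; _×_)
open import Data.Empty using (⊥)
open import Relation.Nullary using (¬_)
open import Relation.Binary.PropositionalEquality using (_≡_)

record Graph (n : ℕ) : Set where
  field
    adj     : Fin n → Fin n → Bool
    symm    : ∀ u w → adj u w ≡ adj w u
    irrefl  : ∀ u → ¬ T (adj u u)
open Graph public

Adj : ∀ {n} → Graph n → Fin n → Fin n → Set
Adj G u w = T (adj G u w)

deg : ∀ {n} → Graph n → Fin n → ℕ
deg {n} G v = length (filterᵇ (adj G v) (allFin n))

_─_ : ∀ {m} → Graph (suc m) → Fin (suc m) → Graph m
adj    (G ─ v) i j = adj G (punchIn v i) (punchIn v j)
symm   (G ─ v) i j = symm G (punchIn v i) (punchIn v j)
irrefl (G ─ v) i   = irrefl G (punchIn v i)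

data Reach {n} (G : Graph n) : Fin n → Fin n → Set where
  here : ∀ {u} → Reach G u u
  step : ∀ {u x w} → Adj G u x → Reach G x w → Reach G u w

Connected : ∀ {n} → Graph n → Set
Connected G = ∀ u w → Reach G u w

-- For a connected graph G, v is a cut vertex iff G - v is disconnected
-- (deleting v increases the number of components).
IsCutVertex : ∀ {m} → Graph (suc m) → Fin (suc m) → Set
IsCutVertex G v = ¬ Connected (G ─ v)

NoIsolated : ∀ {n} → Graph n → Set
NoIsolated G = ∀ u → ∃ λ w → Adj G u w

ProperColoring : ∀ {n} → Graph n → (k : ℕ) → (Fin n → Fin k) → Set
ProperColoring {n} G k c =
  (∀ u w → Adj G u w → ¬ (c u ≡ c w)) × (∀ (j : Fin k) → ∃ λ u → c u ≡ j)

TDColoring : ∀ {n} → Graph n → (k : ℕ) → (Fin n → Fin k) → Set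
TDColoring {n} G k c =
  ProperColoring G k c ×
  (∀ u → ∃ λ (j : Fin k) → ¬ (j ≡ c u) × (∀ w → c w ≡ j → Adj G u w))

HasTDColoring : ∀ {n} → Graph n → ℕ → Set
HasTDColoring {n} G k = ∃ λ (c : Fin n → Fin k) → TDColoring G k c

IsTDChromaticNumber : ∀ {n} → Graph n → ℕ → Set
IsTDChromaticNumber G k =
  HasTDColoring G k × (∀ k′ → HasTDColoring G k′ → k Data.Nat.≤ k′)

-- Upper bound: in a TD-colouring of G - v give v and one neighbour u of v two new colours.
-- Then v dominates {u}, and every other vertex still dominates its old class with u
-- removed, or {u} itself if u was the only member.
-- Lower bound: restrict a TD-colouring of G to G - v. Only neighbours x of v can lose
-- their dominated class, and x is repaired by giving one chosen neighbour of x in G - v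
-- a new singleton colour; this needs at most deg v new colours. If v shares its colour with another vertex, the restriction alone is a
-- TD-colouring; otherwise v's colour disappears, saving one colour.
module Submission where

open import Defs
open import Data.Nat using (ℕ; zero; suc; _+_; _≤_; _<_; s≤s; >-nonZero⁻¹)
import Data.Nat.Properties as ℕ
open import Data.Fin using (Fin; zero; suc; punchIn; punchOut)
open import Data.Fin.Properties
  using (_≟_; any?; all?; ¬∀⟶∃¬; punchIn-punchOut; punchOut-injective; punchOut-cong; punchOut-punchIn; +↔⊎; nonZeroIndex)
open import Data.Vec.Functional using (insertAt)
open import Data.Vec.Functional.Properties using (insertAt-lookup; insertAt-punchIn)
open import Data.Product using (∃; _×_; _,_; proj₁; proj₂)
open import Data.Sum using (_⊎_; inj₁; inj₂)
open import Data.Sum.Properties using (inj₁-injective; inj₂-injective)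
open import Data.Sum.Function.Propositional using (_⊎-↣_)
open import Data.Bool using (T)
open import Data.Empty using (⊥-elim)
open import Data.List using (lookup; filterᵇ; allFin)
open import Data.List.Membership.Propositional.Properties using (∈-filter⁺; ∈-filter⁻; ∈-lookup; ∈-allFin)
open import Data.List.Relation.Unary.Any using (index)
open import Data.List.Relation.Unary.Any.Properties using (lookup-index)
open import Function using (_∘_)
open import Function.Bundles using (_↣_; Injection)
open import Function.Construct.Identity using (↣-id)
open import Function.Construct.Composition using (_↣-∘_)
open import Function.Properties.Inverse using (↔-sym; ↔⇒↣)
open import Relation.Nullary using (¬_; yes; no)
open import Relation.Nullary.Decidable using (T?)
open import Relation.Binary.PropositionalEquality using (_≡_; _≢_; refl; sym; trans; cong; subst)

private variable
  n m k d χ χ′ : ℕ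
  C D : Set

inj₁≢inj₂ : {a : C} {b : D} → inj₁ a ≢ inj₂ b
inj₁≢inj₂ ()

Adj-sym : (G : Graph n) {u w : Fin n} → Adj G u w → Adj G w u
Adj-sym G {u} {w} = subst T (symm G u w)

data PunchInView {m} (v : Fin (suc m)) : Fin (suc m) → Set where
  removed : PunchInView v v
  kept    : ∀ y → PunchInView v (punchIn v y)

punchInView : (v x : Fin (suc m)) → PunchInView v x
punchInView v x with v ≟ x
... | yes refl = removed
... | no v≢x   = subst (PunchInView v) (punchIn-punchOut v≢x) (kept (punchOut v≢x))

Proper : Graph n → (Fin n → C) → Set
Proper G c = ∀ u w → Adj G u w → c u ≢ c w

DominatesClass : Graph n → (Fin n → C) → Fin n → C → Set
DominatesClass G c u j = (∃ λ w → c w ≡ j) × (∀ w → c w ≡ j → Adj G u w)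

-- Unlike TDColoring, colour classes may be empty and the colour type is arbitrary;
-- instead the dominated class must be inhabited, which by properness already makes
-- it differ from the vertex's own class.
TDColoringOn : Graph n → (Fin n → C) → Set
TDColoringOn G c = Proper G c × (∀ u → ∃ (DominatesClass G c u))

dominatedClass-≢ : {G : Graph n} {c : Fin n → C} {u : Fin n} {j : C} →
  Proper G c → DominatesClass G c u j → j ≢ c u
dominatedClass-≢ {u = u} proper ((w , cw≡j) , adj) j≡cu =
  proper u w (adj w cw≡j) (trans (sym j≡cu) (sym cw≡j))

tdColoring⇒tdColoringOn : {G : Graph n} {c : Fin n → Fin k} → TDColoring G k c → TDColoringOn G c
tdColoring⇒tdColoringOn ((proper , onto) , dom) =
  proper , λ u → let (j , _ , adj) = dom u in j , onto j , adj

tdColoringOn⇒tdColoring : {G : Graph n} {c : Fin n → Fin k} →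
  TDColoringOn G c → (∀ j → ∃ λ u → c u ≡ j) → TDColoring G k c
tdColoringOn⇒tdColoring {G = G} (proper , dom) onto =
  (proper , onto) ,
  λ u → let (j , dom-j) = dom u in j , dominatedClass-≢ {G = G} proper dom-j , proj₂ dom-j

tdColoringOn-map : {G : Graph n} {c : Fin n → C} (ι : C ↣ D) →
  TDColoringOn G c → TDColoringOn G (Injection.to ι ∘ c)
tdColoringOn-map ι (proper , dom) =
  (λ u w a → proper u w a ∘ injective) ,
  λ u → let (j , (w , cw≡j) , adj) = dom u in to j , (w , cong to cw≡j) , λ w′ → adj w′ ∘ injective
  where open Injection ι using (to; injective)

tdColoringOn-punchOut : {G : Graph n} {c : Fin n → Fin (suc k)}
  (j : Fin (suc k)) (unused : ∀ u → j ≢ c u) →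
  TDColoringOn G c → TDColoringOn G (λ u → punchOut (unused u))
tdColoringOn-punchOut {G = G} {c = c} j unused (proper , dom) =
  (λ u w a → proper u w a ∘ punchOut-injective (unused u) (unused w)) , dom′
  where
  dom′ : ∀ u → ∃ (DominatesClass G (λ u → punchOut (unused u)) u)
  dom′ u with dom u
  ... | i , (w , cw≡i) , adj = punchOut j≢i , (w , punchOut-cong j cw≡i) ,
                               λ w′ eq → adj w′ (punchOut-injective (unused w′) j≢i eq)
    where
    j≢i : j ≢ i
    j≢i j≡i = unused w (trans j≡i (sym cw≡i))

hasTDColoring-≤ : {G : Graph n} {c : Fin n → Fin k} →
  TDColoringOn G c → ∃ λ k′ → k′ ≤ k × HasTDColoring G k′
hasTDColoring-≤ {k = k} {G = G} {c = c} td with all? (λ j → any? (λ u → c u ≟ j))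
... | yes onto = k , ℕ.≤-refl , c , tdColoringOn⇒tdColoring {G = G} td onto
... | no notOnto with ¬∀⟶∃¬ k _ (λ j → any? (λ u → c u ≟ j)) notOnto
hasTDColoring-≤ {k = suc k} {G = G} td | no _ | j , unused =
  let (k′ , k′≤k , colouring) =
        hasTDColoring-≤ {G = G} (tdColoringOn-punchOut {G = G} j (λ u j≡cu → unused (u , sym j≡cu)) td)
  in k′ , ℕ.m≤n⇒m≤1+n k′≤k , colouring

tdChromatic-≤ : {G : Graph n} {c : Fin n → C} →
  IsTDChromaticNumber G χ → C ↣ Fin k → TDColoringOn G c → χ ≤ k
tdChromatic-≤ {G = G} (_ , minimal) ι td =
  let (k′ , k′≤k , colouring) = hasTDColoring-≤ {G = G} (tdColoringOn-map {G = G} ι td)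
  in ℕ.≤-trans (minimal k′ colouring) k′≤k

tdChromatic-< : {G : Graph n} {c : Fin n → C} →
  IsTDChromaticNumber G χ → C ↣ Fin k → TDColoringOn G c → (a : C) → (∀ u → c u ≢ a) → χ < k
tdChromatic-< {k = zero} _ ι _ a _ with Injection.to ι a
... | ()
tdChromatic-< {k = suc k} {G = G} (_ , minimal) ι td a unused =
  let (k′ , k′≤k , colouring) =
        hasTDColoring-≤ {G = G} (tdColoringOn-punchOut {G = G} (to a) unused′ (tdColoringOn-map {G = G} ι td))
  in s≤s (ℕ.≤-trans (minimal k′ colouring) k′≤k)
  where
  open Injection ι using (to; injective)
  unused′ : ∀ u → to a ≢ to _
  unused′ u eq = unused u (sym (injective eq))

⊎-↣-+ : C ↣ Fin k → (C ⊎ Fin d) ↣ Fin (k + d)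
⊎-↣-+ {d = d} ι = ↔⇒↣ (↔-sym +↔⊎) ↣-∘ (ι ⊎-↣ ↣-id (Fin d))

recolour : (Fin n → C) → (Fin d → Fin n) → Fin n → C ⊎ Fin d
recolour c t x with any? (λ i → t i ≟ x)
... | yes (i , _) = inj₂ i
... | no _        = inj₁ (c x)

module _ {c : Fin n → C} {t : Fin d → Fin n} where

  recolour-view : ∀ x → (∃ λ i → t i ≡ x × recolour c t x ≡ inj₂ i)
                      ⊎ (¬ (∃ λ i → t i ≡ x) × recolour c t x ≡ inj₁ (c x))
  recolour-view x with any? (λ i → t i ≟ x)
  ... | yes (i , ti≡x) = inj₁ (i , ti≡x , refl)
  ... | no ¬image      = inj₂ (¬image , refl)

  recolour-inj₂ : ∀ {x i} → recolour c t x ≡ inj₂ i → t i ≡ x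
  recolour-inj₂ {x} eq with recolour-view x
  ... | inj₁ (i , ti≡x , eq′) = subst (λ i → t i ≡ x) (inj₂-injective (trans (sym eq′) eq)) ti≡x
  ... | inj₂ (_ , eq′)        = ⊥-elim (inj₁≢inj₂ (trans (sym eq′) eq))

  recolour-inj₁ : ∀ {x j} → recolour c t x ≡ inj₁ j → c x ≡ j
  recolour-inj₁ {x} eq with recolour-view x
  ... | inj₁ (_ , _ , eq′) = ⊥-elim (inj₁≢inj₂ (trans (sym eq) eq′))
  ... | inj₂ (_ , eq′)     = inj₁-injective (trans (sym eq′) eq)

  recolour-image : ∀ {x i} → t i ≡ x → ∃ λ i′ → recolour c t x ≡ inj₂ i′
  recolour-image {x} {i} ti≡x with recolour-view x
  ... | inj₁ (i′ , _ , eq) = i′ , eq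
  ... | inj₂ (¬image , _)  = ⊥-elim (¬image (i , ti≡x))

  recolour-singleton : ∀ {x y i} → recolour c t x ≡ inj₂ i → recolour c t y ≡ inj₂ i → x ≡ y
  recolour-singleton ex ey = trans (sym (recolour-inj₂ ex)) (recolour-inj₂ ey)

  recolour-proper : {H : Graph n} → Proper H c → Proper H (recolour c t)
  recolour-proper {H} proper x y a eq with recolour-view x
  ... | inj₁ (_ , _ , ex) = irrefl H x (subst (Adj H x) (sym (recolour-singleton ex (trans (sym eq) ex))) a)
  ... | inj₂ (_ , ex)     = proper x y a (sym (recolour-inj₁ (trans (sym eq) ex)))

  recolouredClass-dominated : {H : Graph n} {x z : Fin n} {i : Fin d} →
    Adj H x z → recolour c t z ≡ inj₂ i → DominatesClass H (recolour c t) x (inj₂ i)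
  recolouredClass-dominated {H} {x} a ez = (_ , ez) , λ w ew → subst (Adj H x) (recolour-singleton ez ew) a

  recolour-dominates : {H : Graph n} {x : Fin n} {j : C} →
    DominatesClass H c x j → ∃ (DominatesClass H (recolour c t) x)
  recolour-dominates {H} ((w , cw≡j) , adj) with recolour-view w
  ... | inj₁ (i , _ , ew) = inj₂ i , recolouredClass-dominated {H = H} (adj w cw≡j) ew
  ... | inj₂ (_ , ew)     = inj₁ _ , (w , trans ew (cong inj₁ cw≡j)) , λ w′ ew′ → adj w′ (recolour-inj₁ ew′)

  tdColoringOn-recolour : {H : Graph n} → TDColoringOn H c → TDColoringOn H (recolour c t)
  tdColoringOn-recolour {H} (proper , dom) =
    recolour-proper {H = H} proper , λ x → recolour-dominates {H = H} (proj₂ (dom x))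

module _ {G : Graph (suc m)} {v : Fin (suc m)} {c : Fin m → C} where

  private
    extended : Fin (suc m) → C ⊎ Fin 1
    extended = insertAt (inj₁ ∘ c) v (inj₂ zero)

    extended-removed : extended v ≡ inj₂ zero
    extended-removed = insertAt-lookup (inj₁ ∘ c) v (inj₂ zero)

    extended-kept : ∀ y → extended (punchIn v y) ≡ inj₁ (c y)
    extended-kept = insertAt-punchIn (inj₁ ∘ c) v (inj₂ zero)

    extended-dominates : {x : Fin (suc m)} {j : C} → (∃ λ y → c y ≡ j) →
      (∀ y → c y ≡ j → Adj G x (punchIn v y)) → DominatesClass G extended x (inj₁ j)
    extended-dominates {x} {j} (y , cy≡j) adj =
      (punchIn v y , trans (extended-kept y) (cong inj₁ cy≡j)) , λ w → member (punchInView v w)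
      where
      member : ∀ {w} → PunchInView v w → extended w ≡ inj₁ j → Adj G x w
      member removed    ev = ⊥-elim (inj₁≢inj₂ (trans (sym ev) extended-removed))
      member (kept y′)  ev = adj y′ (inj₁-injective (trans (sym (extended-kept y′)) ev))

  tdColoringOn-insertAt : TDColoringOn (G ─ v) c →
    (∃ λ j → (∃ λ y → c y ≡ j) × (∀ y → c y ≡ j → Adj G v (punchIn v y))) →
    TDColoringOn G (insertAt (inj₁ ∘ c) v (inj₂ zero))
  tdColoringOn-insertAt (proper , dom) (j , nonempty , adj) =
    (λ x w → proper′ (punchInView v x) (punchInView v w)) , λ x → dom′ (punchInView v x)
    where
    proper′ : ∀ {x w} → PunchInView v x → PunchInView v w → Adj G x w → extended x ≢ extended w
    proper′ removed   removed    a _  = irrefl G v a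
    proper′ removed   (kept y)   _ eq = inj₁≢inj₂ (trans (sym (extended-kept y)) (trans (sym eq) extended-removed))
    proper′ (kept y)  removed    _ eq = inj₁≢inj₂ (trans (sym (extended-kept y)) (trans eq extended-removed))
    proper′ (kept y)  (kept y′)  a eq =
      proper y y′ a (inj₁-injective (trans (sym (extended-kept y)) (trans eq (extended-kept y′))))

    dom′ : ∀ {x} → PunchInView v x → ∃ (DominatesClass G extended x)
    dom′ removed  = inj₁ j , extended-dominates nonempty adj
    dom′ (kept y) = let (j′ , nonempty′ , adj′) = dom y in inj₁ j′ , extended-dominates nonempty′ adj′

tdChromatic-≤-deleteVertex+2 : {G : Graph (suc m)} {v : Fin (suc m)} →
  (∃ λ w → Adj G v w) → IsTDChromaticNumber G χ → HasTDColoring (G ─ v) k → χ ≤ k + 2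
tdChromatic-≤-deleteVertex+2 {m} {k = k} {G} {v} (w , vw) isχ (c , tdc) with punchInView v w
... | removed = ⊥-elim (irrefl G v vw)
... | kept u  =
  ℕ.≤-trans (tdChromatic-≤ {G = G} isχ (⊎-↣-+ (⊎-↣-+ (↣-id (Fin k))))
                           (tdColoringOn-insertAt {G = G} {v} tdRecoloured vDominates))
            (ℕ.≤-reflexive (ℕ.+-assoc k 1 1))
  where
  only-u : Fin 1 → Fin m
  only-u _ = u

  tdRecoloured : TDColoringOn (G ─ v) (recolour c only-u)
  tdRecoloured = tdColoringOn-recolour {H = G ─ v} (tdColoring⇒tdColoringOn {G = G ─ v} tdc)

  vDominates : ∃ λ j → (∃ λ y → recolour c only-u y ≡ j) ×
                       (∀ y → recolour c only-u y ≡ j → Adj G v (punchIn v y))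
  vDominates = let (i , eu) = recolour-image {c = c} {t = only-u} {i = zero} refl in
    inj₂ i , (u , eu) , λ y ey → subst (λ z → Adj G v (punchIn v z)) (recolour-inj₂ ey) vw

neighbour : (G : Graph n) (v : Fin n) → Fin (deg G v) → Fin n
neighbour {n} G v = lookup (filterᵇ (adj G v) (allFin n))

neighbour-adj : (G : Graph n) (v : Fin n) (i : Fin (deg G v)) → Adj G v (neighbour G v i)
neighbour-adj {n} G v i = proj₂ (∈-filter⁻ (λ w → T? (adj G v w)) {xs = allFin n} (∈-lookup i))

neighbour-surjective : (G : Graph n) (v : Fin n) {w : Fin n} → Adj G v w → ∃ λ i → neighbour G v i ≡ w
neighbour-surjective G v {w} vw =
  let w∈N = ∈-filter⁺ (λ w → T? (adj G v w)) (∈-allFin w) vw in index w∈N , sym (lookup-index w∈N)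

deg>0 : (G : Graph n) (v : Fin n) {w : Fin n} → Adj G v w → 0 < deg G v
deg>0 G v vw = >-nonZero⁻¹ _ {{nonZeroIndex (proj₁ (neighbour-surjective G v vw))}}

tdColoringOn-restrict : {G : Graph (suc m)} {v : Fin (suc m)} {c : Fin (suc m) → C} →
  TDColoringOn G c → (∃ λ y → c (punchIn v y) ≡ c v) → TDColoringOn (G ─ v) (c ∘ punchIn v)
tdColoringOn-restrict {G = G} {v} {c} (proper , dom) (y₁ , shared) =
  (λ x y → proper (punchIn v x) (punchIn v y)) , dom′
  where
  dom′ : ∀ x → ∃ (DominatesClass (G ─ v) (c ∘ punchIn v) x)
  dom′ x with dom (punchIn v x)
  ... | j , (w , cw≡j) , adj with punchInView v w
  ...   | removed = j , (y₁ , trans shared cw≡j) , adj ∘ punchIn v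
  ...   | kept y  = j , (y , cw≡j) , adj ∘ punchIn v

tdColoringOn-deleteVertex : {G : Graph (suc m)} {v : Fin (suc m)} {c : Fin (suc m) → C} →
  NoIsolated (G ─ v) → TDColoringOn G c →
  ∃ λ (c′ : Fin m → C ⊎ Fin (deg G v)) →
    TDColoringOn (G ─ v) c′ × (∀ y {j} → c′ y ≡ inj₁ j → c (punchIn v y) ≡ j)
tdColoringOn-deleteVertex {m} {G = G} {v} {c} noIsolated (proper , dom) =
  recolour (c ∘ punchIn v) target ,
  (recolour-proper {H = G ─ v} (λ x y → proper (punchIn v x) (punchIn v y)) , dom′) ,
  λ _ → recolour-inj₁
  where
  v≢neighbour : ∀ i → v ≢ neighbour G v i
  v≢neighbour i v≡w = irrefl G v (subst (Adj G v) (sym v≡w) (neighbour-adj G v i))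

  target : Fin (deg G v) → Fin m
  target i = proj₁ (noIsolated (punchOut (v≢neighbour i)))

  target-covers : ∀ {x} → Adj G v (punchIn v x) → ∃ λ i → target i ≡ proj₁ (noIsolated x)
  target-covers vx = let (i , wᵢ≡x) = neighbour-surjective G v vx in
    i , cong (proj₁ ∘ noIsolated) (trans (punchOut-cong v wᵢ≡x) (punchOut-punchIn v))

  dom′ : ∀ x → ∃ (DominatesClass (G ─ v) (recolour (c ∘ punchIn v) target) x)
  dom′ x with T? (adj G v (punchIn v x)) | dom (punchIn v x)
  ... | yes vx | _ = let (i , ex) = recolour-image (proj₂ (target-covers vx)) in
    inj₂ i , recolouredClass-dominated {H = G ─ v} (proj₂ (noIsolated x)) ex
  ... | no ¬vx | j , (w , cw≡j) , adj with punchInView v w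
  ...   | removed = ⊥-elim (¬vx (Adj-sym G (adj v cw≡j)))
  ...   | kept y  = recolour-dominates {H = G ─ v} ((y , cw≡j) , adj ∘ punchIn v)

tdChromatic-deleteVertex-<-+deg : {G : Graph (suc m)} {v : Fin (suc m)} →
  (∃ λ w → Adj G v w) → NoIsolated (G ─ v) → HasTDColoring G k → IsTDChromaticNumber (G ─ v) χ′ →
  χ′ + 1 ≤ k + deg G v
tdChromatic-deleteVertex-<-+deg {k = k} {χ′} {G} {v} (w , vw) noIsolated (c , tdc) isχ′
  with any? (λ y → c (punchIn v y) ≟ c v)
... | yes shared =
  ℕ.+-mono-≤ (tdChromatic-≤ {G = G ─ v} isχ′ (↣-id (Fin k))
                (tdColoringOn-restrict {G = G} (tdColoring⇒tdColoringOn {G = G} tdc) shared))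
             (deg>0 G v vw)
... | no unique =
  let (c′ , td′ , old) = tdColoringOn-deleteVertex {G = G} {v} noIsolated (tdColoring⇒tdColoringOn {G = G} tdc) in
  ℕ.≤-trans (ℕ.≤-reflexive (ℕ.+-comm χ′ 1))
    (tdChromatic-< {G = G ─ v} isχ′ (⊎-↣-+ (↣-id (Fin k))) td′ (inj₁ (c v)) λ y eq → unique (y , old y eq))

theorem2p3 : ∀ {m} (G : Graph (suc m)) (v : Fin (suc m)) →
    Connected G → ¬ IsCutVertex G v →
    NoIsolated G → NoIsolated (G ─ v) →
    ∀ (χG χGv : ℕ) → IsTDChromaticNumber G χG → IsTDChromaticNumber (G ─ v) χGv →
    (χG ≤ χGv + 2) × (χGv + 1 ≤ χG + deg G v)
theorem2p3 G v _ _ noIsolated noIsolated′ χG χGv isχG isχGv =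
  tdChromatic-≤-deleteVertex+2 {G = G} {v} (noIsolated v) isχG (proj₁ isχGv) ,
  tdChromatic-deleteVertex-<-+deg {G = G} {v} (noIsolated v) noIsolated′ (proj₁ isχG) isχGv
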